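{- Let $k\ge1$, let $G_1,G_2,G_3\in\Delta_{k-1}$, let $v_i\in V(G_i)$ for $i=1,2,3$, and let $G$ be obtained from the disjoint union of $G_1,G_2,G_3$ by adding the triangle $v_1v_2v_3$. If $v\in V(G_1)$, then $\mathrm{norb}(G,v)\ge\mathrm{norb}(G_1,v_1)+\mathrm{norb}(G_2,v_2)$.
   Context: Graphs are finite and simple. $\Delta_0=\{K_2\}$. For $i\ge1$, $\Delta_i$ is the set of all graphs obtained from the disjoint union of three (not necessarily distinct) graphs in $\Delta_{i-1}$ by choosing one vertex in each and adding a triangle on the three chosen vertices, with graphs considered up to isomorphism. For a rooted graph $(G,v)$ (a graph with a vertex $v$), an automorphism of $(G,v)$ is a graph automorphism of $G$ fixing $v$. The orbit of $x\in V(G)$ in $(G,v)$ is $\{f(x): f \text{ an automorphism of }(G,v)\}$, and $\mathrm{norb}(G,v)$ is the number of distinct orbits of $(G,v)$. -}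

module Defs where

open import Data.Nat using (ℕ; _+_)
open import Data.Fin using (Fin; splitAt; _↑ˡ_; _≟_)
open import Data.Bool using (Bool; not; _∧_)
open import Data.Sum using (_⊎_; inj₁; inj₂; map₂)
open import Data.Product using (Σ; ∃; _×_; _,_)
open import Relation.Nullary.Decidable using (does)
open import Relation.Binary.PropositionalEquality using (_≡_)

-- Simplicity (symmetry, irreflexivity) is not built in: every graph in Δ i
-- is simple automatically (K2 is simple and gluing preserves simplicity).
record Graph : Set where
  constructor graph
  field
    n : ℕ
    E : Fin n → Fin n → Bool
open Graph public

record Iso (G H : Graph) : Set where
  field
    to      : Fin (n G) → Fin (n H)
    from    : Fin (n H) → Fin (n G)
    from-to : ∀ x → from (to x) ≡ x
    to-from : ∀ y → to (from y) ≡ y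
    pres    : ∀ x y → E G x y ≡ E H (to x) (to y)

K2 : Graph
K2 = graph 2 (λ x y → not (does (x ≟ y)))

part : ∀ {a b c} → Fin (a + (b + c)) → Fin a ⊎ (Fin b ⊎ Fin c)
part {a} {b} x = map₂ (splitAt b) (splitAt a x)

glue : (G1 G2 G3 : Graph) → Fin (n G1) → Fin (n G2) → Fin (n G3) → Graph
glue G1 G2 G3 v1 v2 v3 = graph (n G1 + (n G2 + n G3)) (λ x y → edge (part x) (part y))
  where
  chosen : Fin (n G1) ⊎ (Fin (n G2) ⊎ Fin (n G3)) → Bool
  chosen (inj₁ a)        = does (a ≟ v1)
  chosen (inj₂ (inj₁ a)) = does (a ≟ v2)
  chosen (inj₂ (inj₂ a)) = does (a ≟ v3)
  edge : Fin (n G1) ⊎ (Fin (n G2) ⊎ Fin (n G3)) → Fin (n G1) ⊎ (Fin (n G2) ⊎ Fin (n G3)) → Bool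
  edge (inj₁ a)        (inj₁ b)        = E G1 a b
  edge (inj₂ (inj₁ a)) (inj₂ (inj₁ b)) = E G2 a b
  edge (inj₂ (inj₂ a)) (inj₂ (inj₂ b)) = E G3 a b
  edge p               q               = chosen p ∧ chosen q

data Δ : ℕ → Graph → Set where
  base : ∀ {G} → Iso K2 G → Δ 0 G
  step : ∀ {i G} (G1 G2 G3 : Graph) → Δ i G1 → Δ i G2 → Δ i G3 →
         (v1 : Fin (n G1)) (v2 : Fin (n G2)) (v3 : Fin (n G3)) →
         Iso (glue G1 G2 G3 v1 v2 v3) G → Δ (ℕ.suc i) G

record Aut (G : Graph) (r : Fin (n G)) : Set where
  field
    to      : Fin (n G) → Fin (n G)
    from    : Fin (n G) → Fin (n G)
    from-to : ∀ x → from (to x) ≡ x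
    to-from : ∀ y → to (from y) ≡ y
    pres    : ∀ x y → E G x y ≡ E G (to x) (to y)
    fix     : to r ≡ r

SameOrbit : (G : Graph) (r : Fin (n G)) → Fin (n G) → Fin (n G) → Set
SameOrbit G r x y = Σ (Aut G r) (λ f → Aut.to f x ≡ y)

NOrb : (G : Graph) (r : Fin (n G)) → ℕ → Set
NOrb G r m = Σ (Fin m → Fin (n G)) λ rep →
  (∀ i j → SameOrbit G r (rep i) (rep j) → i ≡ j) ×
  (∀ x → ∃ λ i → SameOrbit G r x (rep i))

-- Every graph of Δ_i is connected and has 2·3^i vertices, so in G the side
-- G2 ∪ G3 of the cut vertex v1 is connected and strictly larger than G1.
-- Let f be an automorphism of (G, v). If f moved a vertex of G1 out of G1,
-- the image of G1 (connected, containing v) would leave G1 through v1, so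
-- some vertex of G1 is sent to v1. Then f(G2 ∪ G3) can neither lie inside G1
-- (too large), nor avoid G1 (together with the escaped vertex of G1 that is
-- too many vertices for G2 ∪ G3), nor meet both sides (it would enter G1
-- through v1 as well). So f preserves G1 and G2 ∪ G3, fixes v1 and permutes
-- {v2, v3}. If f maps one vertex of G2 into G2, it maps all of G2 into G2:
-- the only edge from G2 to G3 is v2v3, and sending two vertices of G2 onto
-- {v2, v3} = f {v2, v3} would put v3 into G2. Hence f restricts to an
-- automorphism of (G1, v1), and to one of (G2, v2) as soon as it maps a vertex
-- of G2 into G2; so representatives of the orbits of (G1, v1) and of (G2, v2)
-- lie in pairwise distinct orbits of (G, v).
module Submission where

open import Defs
open import Data.Nat using (ℕ; _+_; _∸_; _≤_)
open import Data.Fin using (Fin; _↑ˡ_)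
open import Data.Nat using (suc; _<_; _*_; _^_)
open import Data.Nat.Properties using (m<m+n; m≤m+n; m^n>0; ≤-trans; ≤-antisym; <⇒≱; 1+n≰n)
open import Data.Nat.Tactic.RingSolver using (solve-∀)
open import Data.Fin as Fin using (splitAt; join)
open import Data.Fin.Properties using (injective⇒≤; splitAt-join; join-splitAt; all?; ¬∀⟶∃¬)
open import Data.Bool using (Bool; true; false; not; _∧_)
open import Data.Bool.Properties using (not-¬; ¬-not; ∧-conicalˡ; ∧-conicalʳ) renaming (_≟_ to _≟ᵇ_)
open import Data.Sum using (_⊎_; inj₁; inj₂; map₂; fromInj₁)
open import Data.Product using (Σ; ∃; _×_; _,_; proj₁; proj₂)
open import Data.Unit using (⊤; tt)
open import Data.Empty using (⊥; ⊥-elim)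
open import Function using (_∘_; id)
open import Function.Definitions using (Injective)
open import Function.Consequences.Propositional using (inverseʳ⇒injective; strictlyInverseʳ⇒inverseʳ)
open import Relation.Nullary using (yes; no; does; contradiction)
open import Relation.Nullary.Decidable using (dec-true)
open import Relation.Binary.PropositionalEquality

leftInverse⇒injective : {A B : Set} (f : A → B) (g : B → A) → (∀ x → g (f x) ≡ x) → Injective _≡_ _≡_ f
leftInverse⇒injective f g gf = inverseʳ⇒injective {f⁻¹ = g} f (strictlyInverseʳ⇒inverseʳ f gf)

injective-into⇒≤ : {V : Set} {k l : ℕ} (F : Fin k → V) (ι : Fin l → V) (π : V → Fin l) →
                   Injective _≡_ _≡_ F → (∀ x → ι (π (F x)) ≡ F x) → k ≤ l
injective-into⇒≤ F ι π F-inj lands = injective⇒≤ {f = π ∘ F}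
  λ {x} {y} e → F-inj (trans (sym (lands x)) (trans (cong ι e) (lands y)))

all-or-counterexample : {k : ℕ} (p : Fin k → Bool) (b : Bool) → (∀ c → p c ≡ b) ⊎ ∃ λ c → p c ≡ not b
all-or-counterexample {k} p b with all? (λ c → p c ≟ᵇ b)
... | yes all-b = inj₁ all-b
... | no ¬all-b with ¬∀⟶∃¬ k _ (λ c → p c ≟ᵇ b) ¬all-b
...   | c , pc≢b = inj₂ (c , ¬-not pc≢b)

does-true : {k : ℕ} {a b : Fin k} → does (a Fin.≟ b) ≡ true → a ≡ b
does-true {a = a} {b} h with a Fin.≟ b
... | yes a≡b = a≡b

-- Walks

data Walk {V : Set} (R : V → V → Bool) (P : V → Set) : V → V → Set where
  [_]  : ∀ {x} → P x → Walk R P x x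
  snoc : ∀ {x y z} → Walk R P x y → R y z ≡ true → P z → Walk R P x z

module _ {V : Set} {R : V → V → Bool} {P : V → Set} where

  last∈ : ∀ {x y} → Walk R P x y → P y
  last∈ [ py ]       = py
  last∈ (snoc _ _ pz) = pz

  _++ᵂ_ : ∀ {x y z} → Walk R P x y → Walk R P y z → Walk R P x z
  w ++ᵂ [ _ ]         = w
  w ++ᵂ snoc w′ e pz = snoc (w ++ᵂ w′) e pz

  record Crossing (q : V → Bool) (b : Bool) : Set where
    field
      {source target} : V
      source∈  : P source
      target∈  : P target
      edge     : R source target ≡ true
      source-q : q source ≡ b
      target-q : q target ≡ not b

  crossing : ∀ {x y} (q : V → Bool) {b : Bool} → Walk R P x y → q x ≡ b → q y ≡ not b → Crossing q b
  crossing q [ _ ] qx qy = contradiction (trans (sym qx) qy) (not-¬ refl)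
  crossing q {b} (snoc {y = y} w e pz) qx qz with q y ≟ᵇ b
  ... | yes qy = record { source∈ = last∈ w ; target∈ = pz ; edge = e ; source-q = qy ; target-q = qz }
  ... | no qy≢b = crossing q w qx (¬-not qy≢b)

mapᵂ : {V W : Set} {R : V → V → Bool} {S : W → W → Bool} {P : V → Set} {Q : W → Set} {x y : V}
       (g : V → W) → (∀ a b → R a b ≡ true → S (g a) (g b) ≡ true) → (∀ {a} → P a → Q (g a)) →
       Walk R P x y → Walk S Q (g x) (g y)
mapᵂ g edge pred [ px ]        = [ pred px ]
mapᵂ g edge pred (snoc w e pz) = snoc (mapᵂ g edge pred w) (edge _ _ e) (pred pz)

weaken : {V : Set} {R : V → V → Bool} {P Q : V → Set} {x y : V} →
         (∀ {a} → P a → Q a) → Walk R P x y → Walk R Q x y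
weaken = mapᵂ id (λ _ _ e → e)

forget : {V : Set} {R : V → V → Bool} {P : V → Set} {x y : V} → Walk R P x y → Walk R (λ _ → ⊤) x y
forget = weaken (λ _ → tt)

Image : {V : Set} → (V → V) → (V → Set) → V → Set
Image {V} f P y = Σ V λ x → P x × f x ≡ y

Connected : Graph → Set
Connected G = ∀ x y → Walk (E G) (λ _ → ⊤) x y

-- Automorphisms of a relation on an arbitrary vertex type

record Automorphism {V : Set} (R : V → V → Bool) (r : V) : Set where
  field
    to      : V → V
    from    : V → V
    from-to : ∀ x → from (to x) ≡ x
    to-from : ∀ y → to (from y) ≡ y
    pres    : ∀ x y → R x y ≡ R (to x) (to y)
    fix     : to r ≡ r

  injective : Injective _≡_ _≡_ to
  injective = leftInverse⇒injective to from from-to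

  map-walk : ∀ {P x y} → Walk R P x y → Walk R (Image to P) (to x) (to y)
  map-walk = mapᵂ to (λ x y e → trans (sym (pres x y)) e) (λ {x} px → x , px , refl)

open Automorphism

module _ {V : Set} {R : V → V → Bool} {r : V} where

  infix  30 _⁻¹
  infixr 20 _∘ᴬ_

  _⁻¹ : Automorphism R r → Automorphism R r
  f ⁻¹ = record
    { to = from f ; from = to f ; from-to = to-from f ; to-from = from-to f
    ; pres = λ x y → sym (trans (pres f (from f x) (from f y)) (cong₂ R (to-from f x) (to-from f y)))
    ; fix = trans (cong (from f) (sym (fix f))) (from-to f r) }

  _∘ᴬ_ : Automorphism R r → Automorphism R r → Automorphism R r
  g ∘ᴬ f = record
    { to = to g ∘ to f ; from = from f ∘ from g
    ; from-to = λ x → trans (cong (from f) (from-to g (to f x))) (from-to f x)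
    ; to-from = λ y → trans (cong (to g) (to-from f (from g y))) (to-from g y)
    ; pres = λ x y → trans (pres f x y) (pres g (to f x) (to f y))
    ; fix = trans (cong (to g) (fix f)) (fix g) }

  restrict : (f : Automorphism R r) (H : Graph) (ι : Fin (n H) → V) (π : V → Fin (n H)) →
             (∀ a b → E H a b ≡ R (ι a) (ι b)) →
             (∀ a → ι (π (to f (ι a))) ≡ to f (ι a)) → (∀ a → ι (π (from f (ι a))) ≡ from f (ι a)) →
             (∀ a → π (ι a) ≡ a) → ∀ {h} → to f (ι h) ≡ ι h → Aut H h
  restrict f H ι π E-ι to-stays from-stays π-ι fix-h = record
    { to = λ a → π (to f (ι a))
    ; from = λ a → π (from f (ι a))
    ; from-to = λ a → begin
        π (from f (ι (π (to f (ι a))))) ≡⟨ cong (π ∘ from f) (to-stays a) ⟩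
        π (from f (to f (ι a)))         ≡⟨ cong π (from-to f (ι a)) ⟩
        π (ι a)                         ≡⟨ π-ι a ⟩
        a                               ∎
    ; to-from = λ a → begin
        π (to f (ι (π (from f (ι a))))) ≡⟨ cong (π ∘ to f) (from-stays a) ⟩
        π (to f (from f (ι a)))         ≡⟨ cong π (to-from f (ι a)) ⟩
        π (ι a)                         ≡⟨ π-ι a ⟩
        a                               ∎
    ; pres = λ a b → begin
        E H a b                                      ≡⟨ E-ι a b ⟩
        R (ι a) (ι b)                                ≡⟨ pres f (ι a) (ι b) ⟩
        R (to f (ι a)) (to f (ι b))                  ≡⟨ sym (cong₂ R (to-stays a) (to-stays b)) ⟩
        R (ι (π (to f (ι a)))) (ι (π (to f (ι b))))  ≡⟨ sym (E-ι _ _) ⟩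
        E H (π (to f (ι a))) (π (to f (ι b)))        ∎
    ; fix = trans (cong π fix-h) (π-ι _) }
    where open ≡-Reasoning

Aut⇒Automorphism : {G : Graph} {r : Fin (n G)} → Aut G r → Automorphism (E G) r
Aut⇒Automorphism f = record { F }
  where module F = Aut f

-- The glued graph, with vertex set Fin n1 ⊎ (Fin n2 ⊎ Fin n3)

module Glued (G1 G2 G3 : Graph) (v1 : Fin (n G1)) (v2 : Fin (n G2)) (v3 : Fin (n G3)) where

  n1 n2 n3 : ℕ
  n1 = n G1
  n2 = n G2
  n3 = n G3

  V : Set
  V = Fin n1 ⊎ (Fin n2 ⊎ Fin n3)

  G : Graph
  G = glue G1 G2 G3 v1 v2 v3

  ι₂ : Fin n2 → V
  ι₂ = inj₂ ∘ inj₁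

  ι₃ : Fin n3 → V
  ι₃ = inj₂ ∘ inj₂

  chosen : V → Bool
  chosen (inj₁ a)        = does (a Fin.≟ v1)
  chosen (inj₂ (inj₁ a)) = does (a Fin.≟ v2)
  chosen (inj₂ (inj₂ a)) = does (a Fin.≟ v3)

  adj : V → V → Bool
  adj (inj₁ a)        (inj₁ b)        = E G1 a b
  adj (inj₂ (inj₁ a)) (inj₂ (inj₁ b)) = E G2 a b
  adj (inj₂ (inj₂ a)) (inj₂ (inj₂ b)) = E G3 a b
  adj p               q               = chosen p ∧ chosen q

  toV : Fin (n G) → V
  toV = part {n1} {n2} {n3}

  fromV : V → Fin (n G)
  fromV = join n1 (n2 + n3) ∘ map₂ (join n2 n3)

  toV-fromV : ∀ p → toV (fromV p) ≡ p
  toV-fromV p rewrite splitAt-join n1 (n2 + n3) (map₂ (join n2 n3) p) with p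
  ... | inj₁ a = refl
  ... | inj₂ q = cong inj₂ (splitAt-join n2 n3 q)

  fromV-toV : ∀ x → fromV (toV x) ≡ x
  fromV-toV x with splitAt n1 x in eq
  ... | inj₁ a = trans (cong (join n1 (n2 + n3)) (sym eq)) (join-splitAt n1 (n2 + n3) x)
  ... | inj₂ c = trans (cong (join n1 (n2 + n3) ∘ inj₂) (join-splitAt n2 n3 c))
                       (trans (cong (join n1 (n2 + n3)) (sym eq)) (join-splitAt n1 (n2 + n3) x))

  E-toV : ∀ x y → E G x y ≡ adj (toV x) (toV y)
  E-toV x y with toV x | toV y
  ... | inj₁ _        | inj₁ _        = refl
  ... | inj₁ _        | inj₂ (inj₁ _) = refl
  ... | inj₁ _        | inj₂ (inj₂ _) = refl
  ... | inj₂ (inj₁ _) | inj₁ _        = refl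
  ... | inj₂ (inj₁ _) | inj₂ (inj₁ _) = refl
  ... | inj₂ (inj₁ _) | inj₂ (inj₂ _) = refl
  ... | inj₂ (inj₂ _) | inj₁ _        = refl
  ... | inj₂ (inj₂ _) | inj₂ (inj₁ _) = refl
  ... | inj₂ (inj₂ _) | inj₂ (inj₂ _) = refl

  E-fromV : ∀ p q → E G (fromV p) (fromV q) ≡ adj p q
  E-fromV p q = trans (E-toV (fromV p) (fromV q)) (cong₂ adj (toV-fromV p) (toV-fromV q))

  automorphism-on-V : ∀ {p} → Automorphism (E G) (fromV p) → Automorphism adj p
  automorphism-on-V {p} f = record
    { to = toV ∘ to f ∘ fromV
    ; from = toV ∘ from f ∘ fromV
    ; from-to = λ q → begin
        toV (from f (fromV (toV (to f (fromV q))))) ≡⟨ cong (toV ∘ from f) (fromV-toV _) ⟩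
        toV (from f (to f (fromV q)))               ≡⟨ cong toV (from-to f _) ⟩
        toV (fromV q)                               ≡⟨ toV-fromV q ⟩
        q                                           ∎
    ; to-from = λ q → begin
        toV (to f (fromV (toV (from f (fromV q))))) ≡⟨ cong (toV ∘ to f) (fromV-toV _) ⟩
        toV (to f (from f (fromV q)))               ≡⟨ cong toV (to-from f _) ⟩
        toV (fromV q)                               ≡⟨ toV-fromV q ⟩
        q                                           ∎
    ; pres = λ q q′ → begin
        adj q q′                                        ≡⟨ sym (E-fromV q q′) ⟩
        E G (fromV q) (fromV q′)                        ≡⟨ pres f _ _ ⟩
        E G (to f (fromV q)) (to f (fromV q′))          ≡⟨ E-toV _ _ ⟩
        adj (toV (to f (fromV q))) (toV (to f (fromV q′))) ∎
    ; fix = trans (cong toV (fix f)) (toV-fromV p) }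
    where open ≡-Reasoning

  inG1 : V → Bool
  inG1 (inj₁ _) = true
  inG1 (inj₂ _) = false

  inG2 : V → Bool
  inG2 (inj₂ (inj₁ _)) = true
  inG2 _               = false

  In₁ In₂ In₂₃ : V → Set
  In₁ p = inG1 p ≡ true
  In₂ p = inG2 p ≡ true
  In₂₃ p = inG1 p ≡ false

  In₂⇒In₂₃ : ∀ {p} → In₂ p → In₂₃ p
  In₂⇒In₂₃ {inj₂ (inj₁ _)} _ = refl

  π₁ : V → Fin n1
  π₁ = fromInj₁ (λ _ → v1)

  ι₁-π₁ : ∀ p → In₁ p → inj₁ (π₁ p) ≡ p
  ι₁-π₁ (inj₁ _) _ = refl

  π₂ : V → Fin n2
  π₂ (inj₂ (inj₁ b)) = b
  π₂ _               = v2

  ι₂-π₂ : ∀ p → In₂ p → ι₂ (π₂ p) ≡ p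
  ι₂-π₂ (inj₂ (inj₁ _)) _ = refl

  -- G2 ∪ G3 indexed by Fin (n2 + n3), to count its vertices
  ι₂₃ : Fin (n2 + n3) → V
  ι₂₃ = inj₂ ∘ splitAt n2

  π₂₃ : V → Fin (n2 + n3)
  π₂₃ (inj₁ _) = join n2 n3 (inj₁ v2)
  π₂₃ (inj₂ q) = join n2 n3 q

  ι₂₃-π₂₃ : ∀ p → In₂₃ p → ι₂₃ (π₂₃ p) ≡ p
  ι₂₃-π₂₃ (inj₂ q) _ = cong inj₂ (splitAt-join n2 n3 q)

  ι₂₃-injective : Injective _≡_ _≡_ ι₂₃
  ι₂₃-injective = leftInverse⇒injective ι₂₃ π₂₃ (join-splitAt n2 n3)

  t₁ t₂ t₃ : V
  t₁ = inj₁ v1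
  t₂ = ι₂ v2
  t₃ = ι₃ v3

  chosen-t₁ : chosen t₁ ≡ true
  chosen-t₁ = dec-true (v1 Fin.≟ v1) refl

  chosen-t₂ : chosen t₂ ≡ true
  chosen-t₂ = dec-true (v2 Fin.≟ v2) refl

  chosen-t₃ : chosen t₃ ≡ true
  chosen-t₃ = dec-true (v3 Fin.≟ v3) refl

  t₁t₂ : adj t₁ t₂ ≡ true
  t₁t₂ = cong₂ _∧_ chosen-t₁ chosen-t₂

  t₂t₁ : adj t₂ t₁ ≡ true
  t₂t₁ = cong₂ _∧_ chosen-t₂ chosen-t₁

  t₁t₃ : adj t₁ t₃ ≡ true
  t₁t₃ = cong₂ _∧_ chosen-t₁ chosen-t₃

  t₂t₃ : adj t₂ t₃ ≡ true
  t₂t₃ = cong₂ _∧_ chosen-t₂ chosen-t₃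

  t₃t₂ : adj t₃ t₂ ≡ true
  t₃t₂ = cong₂ _∧_ chosen-t₃ chosen-t₂

  exit-G1 : ∀ {p q} → adj p q ≡ true → In₁ p → In₂₃ q → p ≡ t₁
  exit-G1 {inj₁ _} {inj₂ (inj₁ _)} e _ _ = cong inj₁ (does-true (∧-conicalˡ _ _ e))
  exit-G1 {inj₁ _} {inj₂ (inj₂ _)} e _ _ = cong inj₁ (does-true (∧-conicalˡ _ _ e))

  enter-G1 : ∀ {p q} → adj p q ≡ true → In₂₃ p → In₁ q → q ≡ t₁
  enter-G1 {inj₂ (inj₁ _)} {inj₁ _} e _ _ = cong inj₁ (does-true (∧-conicalʳ _ _ e))
  enter-G1 {inj₂ (inj₂ _)} {inj₁ _} e _ _ = cong inj₁ (does-true (∧-conicalʳ _ _ e))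

  exit-G2-within-G23 : ∀ {p q} → adj p q ≡ true → In₂₃ p → In₂₃ q → In₂ p → inG2 q ≡ false →
                       p ≡ t₂ × q ≡ t₃
  exit-G2-within-G23 {inj₂ (inj₁ _)} {inj₂ (inj₂ _)} e _ _ _ _ =
    cong ι₂ (does-true (∧-conicalˡ _ _ e)) , cong ι₃ (does-true (∧-conicalʳ _ _ e))

  t₁-neighbours : ∀ {q} → In₂₃ q → adj t₁ q ≡ true → q ≡ t₂ ⊎ q ≡ t₃
  t₁-neighbours {inj₂ (inj₁ _)} _ e = inj₁ (cong ι₂ (does-true (∧-conicalʳ _ _ e)))
  t₁-neighbours {inj₂ (inj₂ _)} _ e = inj₂ (cong ι₃ (does-true (∧-conicalʳ _ _ e)))

  module Walks (c1 : Connected G1) (c2 : Connected G2) (c3 : Connected G3) where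

    walk₁ : ∀ a b → Walk adj In₁ (inj₁ a) (inj₁ b)
    walk₁ a b = mapᵂ inj₁ (λ _ _ e → e) (λ _ → refl) (c1 a b)

    walk₂ : ∀ a b → Walk adj In₂ (ι₂ a) (ι₂ b)
    walk₂ a b = mapᵂ ι₂ (λ _ _ e → e) (λ _ → refl) (c2 a b)

    walk₃ : ∀ a b → Walk adj In₂₃ (ι₃ a) (ι₃ b)
    walk₃ a b = mapᵂ ι₃ (λ _ _ e → e) (λ _ → refl) (c3 a b)

    walk₂′ : ∀ a b → Walk adj In₂₃ (ι₂ a) (ι₂ b)
    walk₂′ a b = weaken In₂⇒In₂₃ (walk₂ a b)

    walk₂₃ : ∀ q q′ → Walk adj In₂₃ (inj₂ q) (inj₂ q′)
    walk₂₃ (inj₁ a) (inj₁ b) = walk₂′ a b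
    walk₂₃ (inj₁ a) (inj₂ b) = snoc (walk₂′ a v2) t₂t₃ refl ++ᵂ walk₃ v3 b
    walk₂₃ (inj₂ a) (inj₁ b) = snoc (walk₃ a v3) t₃t₂ refl ++ᵂ walk₂′ v2 b
    walk₂₃ (inj₂ a) (inj₂ b) = walk₃ a b

    walk : ∀ p q → Walk adj (λ _ → ⊤) p q
    walk (inj₁ a) (inj₁ b)  = forget (walk₁ a b)
    walk (inj₁ a) (inj₂ q)  = snoc (forget (walk₁ a v1)) t₁t₂ tt ++ᵂ forget (walk₂₃ (inj₁ v2) q)
    walk (inj₂ q) (inj₁ a)  = snoc (forget (walk₂₃ q (inj₁ v2))) t₂t₁ tt ++ᵂ forget (walk₁ v1 a)
    walk (inj₂ q) (inj₂ q′) = forget (walk₂₃ q q′)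

    glue-connected : Connected G
    glue-connected x y = subst₂ (Walk (E G) (λ _ → ⊤)) (fromV-toV x) (fromV-toV y)
      (mapᵂ fromV (λ p q e → trans (E-fromV p q) e) (λ _ → tt) (walk (toV x) (toV y)))

    module Rooted (v : Fin n1) (G1-smaller : n1 < n2 + n3) where

      Auto : Set
      Auto = Automorphism adj (inj₁ v)

      module _ (f : Auto) where

        G1-preimage-of-t₁ : ∀ a → In₂₃ (to f (inj₁ a)) → Image (to f) In₁ t₁
        G1-preimage-of-t₁ a out with crossing inG1 (subst (λ x → Walk adj (Image (to f) In₁) x (to f (inj₁ a)))
                                                          (fix f) (map-walk f (walk₁ v a))) refl out
        ... | record { source∈ = s , s∈ , fs ; edge = e ; source-q = sq ; target-q = tq } =
          s , s∈ , trans fs (exit-G1 e sq tq)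

        G23-preimage-of-t₁ : ∀ c c′ → In₂₃ (to f (ι₂₃ c)) → In₁ (to f (ι₂₃ c′)) → Image (to f) In₂₃ t₁
        G23-preimage-of-t₁ c c′ out in₁
          with crossing inG1 (map-walk f (walk₂₃ (splitAt n2 c) (splitAt n2 c′))) out in₁
        ... | record { target∈ = t , t∈ , ft ; edge = e ; source-q = sq ; target-q = tq } =
          t , t∈ , trans ft (enter-G1 e sq tq)

        G1-cannot-leave : ∀ a → In₂₃ (to f (inj₁ a)) → ⊥
        G1-cannot-leave a out with G1-preimage-of-t₁ a out | all-or-counterexample (inG1 ∘ to f ∘ ι₂₃) false
        ... | _ | inj₁ all-out = 1+n≰n (injective-into⇒≤ (to f ∘ extend) ι₂₃ π₂₃
                                                          (extend-injective ∘ injective f)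
                                                          (λ k → ι₂₃-π₂₃ _ (extend-out k)))
          where
          extend : Fin (suc (n2 + n3)) → V
          extend Fin.zero    = inj₁ a
          extend (Fin.suc c) = ι₂₃ c
          extend-injective : Injective _≡_ _≡_ extend
          extend-injective {Fin.zero}  {Fin.zero}   _ = refl
          extend-injective {Fin.suc c} {Fin.suc c′} e = cong Fin.suc (ι₂₃-injective e)
          extend-out : ∀ k → In₂₃ (to f (extend k))
          extend-out Fin.zero    = out
          extend-out (Fin.suc c) = all-out c
        ... | s , s∈ , fs | inj₂ (c , c-in) with all-or-counterexample (inG1 ∘ to f ∘ ι₂₃) true
        ...   | inj₁ all-in = <⇒≱ G1-smaller (injective-into⇒≤ (to f ∘ ι₂₃) inj₁ π₁
                                                              (ι₂₃-injective ∘ injective f)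
                                                              (λ c → ι₁-π₁ _ (all-in c)))
        ...   | inj₂ (c′ , c′-out) with G23-preimage-of-t₁ c′ c c′-out c-in
        ...     | t , t∈ , ft with () ← trans (sym s∈) (trans (cong inG1 (injective f (trans fs (sym ft)))) t∈)

      G1-to-G1 : (f : Auto) → ∀ a → In₁ (to f (inj₁ a))
      G1-to-G1 f a with inG1 (to f (inj₁ a)) in eq
      ... | true  = refl
      ... | false = ⊥-elim (G1-cannot-leave f a eq)

      G23-to-G23 : (f : Auto) → ∀ {p} → In₂₃ p → In₂₃ (to f p)
      G23-to-G23 f {p} p∈ with inG1 (to f p) in eq
      ... | false = refl
      ... | true with () ← trans (sym (G1-to-G1 (f ⁻¹) (π₁ (to f p))))
                                 (trans (cong (inG1 ∘ from f) (ι₁-π₁ _ eq)) (trans (cong inG1 (from-to f p)) p∈))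

      fixes-t₁ : (f : Auto) → to f t₁ ≡ t₁
      fixes-t₁ f = exit-G1 (trans (sym (pres f t₁ t₂)) t₁t₂) (G1-to-G1 f v1) (G23-to-G23 f refl)

      t₁-neighbour-image : (f : Auto) → ∀ {q} → In₂₃ q → adj t₁ q ≡ true → to f q ≡ t₂ ⊎ to f q ≡ t₃
      t₁-neighbour-image f {q} q∈ e = t₁-neighbours (G23-to-G23 f q∈)
        (subst (λ z → adj z (to f q) ≡ true) (fixes-t₁ f) (trans (sym (pres f t₁ q)) e))

      G2-to-G2 : (f : Auto) → ∀ {x y} → to f (ι₂ x) ≡ ι₂ y → ∀ b → In₂ (to f (ι₂ b))
      G2-to-G2 f {x} h b with inG2 (to f (ι₂ b)) in eq
      ... | true  = refl
      ... | false with crossing inG2 (map-walk f (walk₂ x b)) (cong inG2 h) eq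
      ...   | record { source∈ = s , s∈ , fs ; target∈ = t , t∈ , ft ; edge = e ; source-q = sq ; target-q = tq }
        with exit-G2-within-G23 e (subst In₂₃ fs (G23-to-G23 f (In₂⇒In₂₃ s∈)))
                                  (subst In₂₃ ft (G23-to-G23 f (In₂⇒In₂₃ t∈))) sq tq
                 | t₁-neighbour-image f {t₃} refl t₁t₃
      ...     | fs≡t₂ , _ | inj₁ ft₃≡t₂
        with () ← trans (sym s∈) (cong inG2 (injective f (trans (trans fs fs≡t₂) (sym ft₃≡t₂))))
      ...     | _ , ft≡t₃ | inj₂ ft₃≡t₃
        with () ← trans (sym t∈) (cong inG2 (injective f (trans (trans ft ft≡t₃) (sym ft₃≡t₃))))

      fixes-t₂ : (f : Auto) → ∀ {x y} → to f (ι₂ x) ≡ ι₂ y → to f t₂ ≡ t₂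
      fixes-t₂ f h with t₁-neighbour-image f {t₂} refl t₁t₂
      ... | inj₁ ft₂≡t₂ = ft₂≡t₂
      ... | inj₂ ft₂≡t₃ with () ← trans (sym (G2-to-G2 f h v2)) (cong inG2 ft₂≡t₃)

      restrict₁ : Auto → Aut G1 v1
      restrict₁ f = restrict f G1 inj₁ π₁ (λ _ _ → refl)
        (λ a → ι₁-π₁ _ (G1-to-G1 f a)) (λ a → ι₁-π₁ _ (G1-to-G1 (f ⁻¹) a)) (λ _ → refl) (fixes-t₁ f)

      restrict₂ : (f : Auto) → ∀ {x y} → to f (ι₂ x) ≡ ι₂ y → Aut G2 v2
      restrict₂ f {x} {y} h = restrict f G2 ι₂ π₂ (λ _ _ → refl)
        (λ b → ι₂-π₂ _ (G2-to-G2 f h b)) (λ b → ι₂-π₂ _ (G2-to-G2 (f ⁻¹) h⁻¹ b)) (λ _ → refl) (fixes-t₂ f h)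
        where
        h⁻¹ : from f (ι₂ y) ≡ ι₂ x
        h⁻¹ = trans (cong (from f) (sym h)) (from-to f (ι₂ x))

      norb-sum-≤ : ∀ {m m1 m2} → NOrb G (fromV (inj₁ v)) m → NOrb G1 v1 m1 → NOrb G2 v2 m2 → m1 + m2 ≤ m
      norb-sum-≤ {m} {m1} {m2} (rep , _ , cover) (rep₁ , distinct₁ , _) (rep₂ , distinct₂ , _) =
        injective⇒≤ {f = orbit ∘ representative ∘ splitAt m1}
          λ e → splitAt-injective (representative-distinct (same-orbit e))
        where
        representative : Fin m1 ⊎ Fin m2 → V
        representative (inj₁ i) = inj₁ (rep₁ i)
        representative (inj₂ j) = ι₂ (rep₂ j)

        orbit : V → Fin m
        orbit p = proj₁ (cover (fromV p))

        splitAt-injective : Injective _≡_ _≡_ (splitAt m1 {m2})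
        splitAt-injective = leftInverse⇒injective (splitAt m1) (join m1 m2) (join-splitAt m1 m2)

        same-orbit : ∀ {p p′} → orbit p ≡ orbit p′ → Σ Auto λ f → to f p ≡ p′
        same-orbit {p} {p′} e = automorphism-on-V (Aut⇒Automorphism b ⁻¹ ∘ᴬ Aut⇒Automorphism a) , (begin
            toV (Aut.from b (Aut.to a (fromV p)))   ≡⟨ cong (toV ∘ Aut.from b) (trans ap (cong rep e)) ⟩
            toV (Aut.from b (rep (orbit p′)))      ≡⟨ cong (toV ∘ Aut.from b) (sym bp′) ⟩
            toV (Aut.from b (Aut.to b (fromV p′))) ≡⟨ cong toV (Aut.from-to b (fromV p′)) ⟩
            toV (fromV p′)                         ≡⟨ toV-fromV p′ ⟩
            p′                                     ∎)
          where
          open ≡-Reasoning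
          a b : Aut G (fromV (inj₁ v))
          a = proj₁ (proj₂ (cover (fromV p)))
          b = proj₁ (proj₂ (cover (fromV p′)))
          ap : Aut.to a (fromV p) ≡ rep (orbit p)
          ap = proj₂ (proj₂ (cover (fromV p)))
          bp′ : Aut.to b (fromV p′) ≡ rep (orbit p′)
          bp′ = proj₂ (proj₂ (cover (fromV p′)))

        representative-distinct : ∀ {s s′} → Σ Auto (λ f → to f (representative s) ≡ representative s′) → s ≡ s′
        representative-distinct {inj₁ i} {inj₁ i′} (f , e) = cong inj₁ (distinct₁ i i′ (restrict₁ f , cong π₁ e))
        representative-distinct {inj₂ j} {inj₂ j′} (f , e) = cong inj₂ (distinct₂ j j′ (restrict₂ f e , cong π₂ e))
        representative-distinct {inj₁ i} {inj₂ j}  (f , e) with () ← trans (sym (G1-to-G1 f (rep₁ i))) (cong inG1 e)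
        representative-distinct {inj₂ j} {inj₁ i}  (f , e) with () ← trans (sym (G23-to-G23 f refl)) (cong inG1 e)

-- Members of Δ i

Iso-order : ∀ {G H} → Iso G H → n G ≡ n H
Iso-order φ = ≤-antisym (injective⇒≤ (leftInverse⇒injective φ.to φ.from φ.from-to))
                        (injective⇒≤ (leftInverse⇒injective φ.from φ.to φ.to-from))
  where module φ = Iso φ

Iso-connected : ∀ {G H} → Iso G H → Connected G → Connected H
Iso-connected {G} {H} φ c x y = subst₂ (Walk (E H) (λ _ → ⊤)) (φ.to-from x) (φ.to-from y)
  (mapᵂ φ.to (λ a b e → trans (sym (φ.pres a b)) e) (λ _ → tt) (c (φ.from x) (φ.from y)))
  where module φ = Iso φ

K2-connected : Connected K2
K2-connected Fin.zero           Fin.zero           = [ tt ]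
K2-connected Fin.zero           (Fin.suc Fin.zero) = snoc [ tt ] refl tt
K2-connected (Fin.suc Fin.zero) Fin.zero           = snoc [ tt ] refl tt
K2-connected (Fin.suc Fin.zero) (Fin.suc Fin.zero) = [ tt ]

Δ-connected : ∀ {i G} → Δ i G → Connected G
Δ-connected (base I) = Iso-connected I K2-connected
Δ-connected (step G1 G2 G3 d1 d2 d3 v1 v2 v3 I) = Iso-connected I glue-connected
  where open Glued.Walks G1 G2 G3 v1 v2 v3 (Δ-connected d1) (Δ-connected d2) (Δ-connected d3)

Δ-order : ∀ {i G} → Δ i G → n G ≡ 2 * 3 ^ i
Δ-order (base I) = sym (Iso-order I)
Δ-order {suc i} {G} (step G1 G2 G3 d1 d2 d3 _ _ _ I) = begin
  n G                                 ≡⟨ sym (Iso-order I) ⟩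
  n G1 + (n G2 + n G3)                ≡⟨ cong₂ _+_ (Δ-order d1) (cong₂ _+_ (Δ-order d2) (Δ-order d3)) ⟩
  2 * 3 ^ i + (2 * 3 ^ i + 2 * 3 ^ i) ≡⟨ thrice (3 ^ i) ⟩
  2 * 3 ^ suc i                       ∎
  where
  open ≡-Reasoning
  thrice : ∀ x → 2 * x + (2 * x + 2 * x) ≡ 2 * (3 * x)
  thrice = solve-∀

Δ-order-< : ∀ {i G1 G2 G3} → Δ i G1 → Δ i G2 → Δ i G3 → n G1 < n G2 + n G3
Δ-order-< {i} d1 d2 d3 rewrite Δ-order d1 | Δ-order d2 | Δ-order d3 =
  m<m+n (2 * 3 ^ i) (≤-trans (m^n>0 3 i) (m≤m+n (3 ^ i) _))

lemma5p3 : (k : ℕ) → 1 ≤ k → (G1 G2 G3 : Graph) → Δ (k ∸ 1) G1 → Δ (k ∸ 1) G2 → Δ (k ∸ 1) G3 → (v1 : Fin (n G1)) (v2 : Fin (n G2)) (v3 : Fin (n G3)) → (v : Fin (n G1)) → (m m1 m2 : ℕ) → NOrb (glue G1 G2 G3 v1 v2 v3) (v ↑ˡ (n G2 + n G3)) m → NOrb G1 v1 m1 → NOrb G2 v2 m2 → m1 + m2 ≤ m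
lemma5p3 k _ G1 G2 G3 d1 d2 d3 v1 v2 v3 v m m1 m2 = norb-sum-≤
  where
  open Glued G1 G2 G3 v1 v2 v3
  open Walks (Δ-connected d1) (Δ-connected d2) (Δ-connected d3)
  open Rooted v (Δ-order-< d1 d2 d3)
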